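{- For every $n\ge1$, $\mathrm{Hun}(Q^n)\le\binom{n}{\lfloor n/2\rfloor}$.
   Context: $Q^n$ has vertex set the subsets of $[n]$, with $x\sim y$ iff $|x\triangle y|=1$. Hunter strategy on a graph $G$: finite sequence $H=(H_1,\dots,H_m)$ of multisets of vertices; with $N(S)$ the set of vertices adjacent to some vertex of $S$, set $R_H(0)=V(G)$, $R_H(i)=N(R_H(i-1)\setminus H_i)$; winning if $R_H(i)=\emptyset$ for some $i$. $\mathrm{Hun}(G)$ is the minimum over winning strategies of $\max_i|H_i|$ (multiplicities counted). -}

module Defs where

open import Data.Nat using (ℕ; _≤_)
open import Data.Bool using (Bool; _xor_)
open import Data.Vec using (zipWith)
open import Data.Fin.Subset using (Subset; ∣_∣)
open import Data.List using (List; []; _∷_; length)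
open import Data.List.Membership.Propositional using (_∈_)
open import Data.List.Relation.Unary.All using (All)
open import Data.Product using (Σ; ∃; _×_)
open import Data.Sum using (_⊎_)
open import Data.Unit using (⊤)
open import Relation.Nullary using (¬_)
open import Relation.Binary.PropositionalEquality using (_≡_)

record Graph : Set₁ where
  field
    V   : Set
    _~_ : V → V → Set

open Graph public

_△_ : ∀ {n} → Subset n → Subset n → Subset n
x △ y = zipWith _xor_ x y

Q : ℕ → Graph
Q n = record { V = Subset n ; _~_ = λ x y → ∣ x △ y ∣ ≡ 1 }

-- N(S \ h): vertices adjacent to some vertex of S not shot at in h.
-- (A multiset of vertices is a List; membership ignores multiplicity,
--  size counts multiplicity.)
step : (G : Graph) → (V G → Set) → List (V G) → (V G → Set)
step G R h v = Σ (V G) λ u → R u × ¬ (u ∈ h) × _~_ G u v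

-- Wins G R H: starting from territory R = R_H(0), some R_H(i) with
-- 0 ≤ i ≤ length H is empty.
Wins : (G : Graph) → (V G → Set) → List (List (V G)) → Set
Wins G R []      = ∀ v → ¬ R v
Wins G R (h ∷ H) = (∀ v → ¬ R v) ⊎ Wins G (step G R h) H

Winning : (G : Graph) → List (List (V G)) → Set
Winning G H = Wins G (λ _ → ⊤) H

Hun≤ : Graph → ℕ → Set
Hun≤ G k = ∃ λ (H : List (List (V G))) → Winning G H × All (λ h → length h ≤ k) H

-- The hunter sweeps the levels of the cube, shooting at every vertex of size
-- 0, 1, 2, ... in consecutive rounds.  A rabbit changes level by one each
-- round, so a rabbit whose level has the parity of the level being shot and
-- lies at or above it can never jump over the sweep front: it is caught before
-- the front passes n.  After one sweep of odd length 2n + 1 (the levels above n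
-- are empty) all surviving rabbits therefore have even level, which is exactly
-- the parity that a second sweep from level 0 catches.  Level k has n C k
-- vertices, and n C k ≤ n C ⌊n/2⌋ by unimodality of the binomial coefficients.

module Submission where

open import Defs
open import Data.Nat using (ℕ; _≤_; _/_)
open import Data.Nat.Combinatorics using (_C_)

open import Level using (0ℓ)
open import Data.Nat
  using (zero; suc; _+_; _∸_; _<_; _≤′_; ≤′-refl; ≤′-step; z≤n; s≤s; ⌊_/2⌋; ⌈_/2⌉; _≤?_; parity)
open import Data.Nat.Properties
open import Data.Nat.DivMod using (m/n≡1+[m∸n]/n)
open import Data.Nat.Combinatorics
  using (nC1≡n; nCk≡nC[n∸k]; nCk+nC[k+1]≡[n+1]C[k+1]; k>n⇒nCk≡0)
open import Data.Parity using (0ℙ; 1ℙ; _⁻¹)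
open import Data.Parity.Properties
  using (suc-homo-⁻¹; ⁻¹-selfInverse; ⁻¹-involutive; p≢p⁻¹; +-homo-+; p+p≡0ℙ)
open import Data.Vec using ([]; _∷_)
open import Data.Fin.Subset using (Subset; ∣_∣; inside; outside)
open import Data.Fin.Subset.Properties using (∣p∣≤n)
open import Data.List using (List; []; _∷_; _++_; [_]; length; map; applyUpTo)
open import Data.List.Properties using (length-++; length-map)
open import Data.List.Membership.Propositional using (_∈_)
open import Data.List.Membership.Propositional.Properties using (∈-map⁺; ∈-++⁺ˡ; ∈-++⁺ʳ)
open import Data.List.Relation.Unary.Any using (here)
open import Data.List.Relation.Unary.All using (All)
open import Data.List.Relation.Unary.All.Properties using (++⁺; applyUpTo⁺₂)
open import Data.Product using (_,_)
open import Data.Sum using (_⊎_; inj₁; inj₂)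
open import Relation.Nullary using (¬_; yes; no; contradiction)
open import Relation.Unary using (Pred; _⊆_; _∩_; Empty; U)
open import Relation.Binary.PropositionalEquality
  using (_≡_; _≢_; refl; sym; trans; cong; cong₂; subst; subst₂; module ≡-Reasoning)

nCk≤nC[1+k] : ∀ n k → k + k < n → n C k ≤ n C suc k
nCk≤nC[1+k] n       zero    0<n = subst (1 ≤_) (sym (nC1≡n n)) 0<n
nCk≤nC[1+k] (suc n) (suc k) 2k+2<1+n = begin
  suc n C suc k            ≡⟨ nCk+nC[k+1]≡[n+1]C[k+1] n k ⟨
  n C k + n C suc k        ≤⟨ +-monoˡ-≤ (n C suc k) nCk≤nC[2+k] ⟩
  n C suc (suc k) + n C suc k ≡⟨ +-comm (n C suc (suc k)) (n C suc k) ⟩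
  n C suc k + n C suc (suc k) ≡⟨ nCk+nC[k+1]≡[n+1]C[k+1] n (suc k) ⟩
  suc n C suc (suc k)      ∎
  where
  open ≤-Reasoning
  2k+2≤n : suc (suc (k + k)) ≤ n
  2k+2≤n = ≤-pred (subst (λ m → suc (suc m) ≤ suc n) (+-suc k k) 2k+2<1+n)
  nCk≤nC[2+k] : n C k ≤ n C suc (suc k)
  nCk≤nC[2+k] with m≤n⇒m<n∨m≡n 2k+2≤n
  ... | inj₁ 2k+2<n = ≤-trans (nCk≤nC[1+k] n k (≤-trans (m≤n+m (suc (k + k)) 2) 2k+2<n))
                              (nCk≤nC[1+k] n (suc k) (subst (_< n) (cong suc (sym (+-suc k k))) 2k+2<n))
  ... | inj₂ 2k+2≡n = subst (λ m → m C k ≤ m C suc (suc k)) 2k+2≡n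
    (≤-reflexive (trans (nCk≡nC[n∸k] (m≤n+m k (suc (suc k))))
                        (cong (suc (suc (k + k)) C_) (m+n∸n≡m (suc (suc k)) k))))

nCj≤nCk : ∀ {n j k} → j ≤′ k → k + k ≤ n → n C j ≤ n C k
nCj≤nCk ≤′-refl             _       = ≤-refl
nCj≤nCk {n} {k = suc k} (≤′-step j≤′k) 2k+2≤n =
  ≤-trans (nCj≤nCk j≤′k (<⇒≤ 2k<n)) (nCk≤nC[1+k] n k 2k<n)
  where
  2k<n : k + k < n
  2k<n = ≤-trans (s≤s (+-monoʳ-≤ k (n≤1+n k))) 2k+2≤n

n/2≡⌊n/2⌋ : ∀ n → n / 2 ≡ ⌊ n /2⌋
n/2≡⌊n/2⌋ 0             = refl
n/2≡⌊n/2⌋ 1             = refl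
n/2≡⌊n/2⌋ (suc (suc n)) =
  trans (m/n≡1+[m∸n]/n {suc (suc n)} {2} (s≤s (s≤s z≤n))) (cong suc (n/2≡⌊n/2⌋ n))

2⌊n/2⌋≤n : ∀ n → ⌊ n /2⌋ + ⌊ n /2⌋ ≤ n
2⌊n/2⌋≤n n = subst (⌊ n /2⌋ + ⌊ n /2⌋ ≤_) (⌊n/2⌋+⌈n/2⌉≡n n) (+-monoʳ-≤ ⌊ n /2⌋ (⌊n/2⌋≤⌈n/2⌉ n))

n∸k≤⌊n/2⌋ : ∀ n k → ⌊ n /2⌋ < k → n ∸ k ≤ ⌊ n /2⌋
n∸k≤⌊n/2⌋ n k ⌊n/2⌋<k = begin
  n ∸ k                          ≤⟨ ∸-monoʳ-≤ n (≤-trans ⌈n/2⌉≤1+⌊n/2⌋ ⌊n/2⌋<k) ⟩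
  n ∸ ⌈ n /2⌉                    ≡⟨ cong (_∸ ⌈ n /2⌉) (⌊n/2⌋+⌈n/2⌉≡n n) ⟨
  ⌊ n /2⌋ + ⌈ n /2⌉ ∸ ⌈ n /2⌉    ≡⟨ m+n∸n≡m ⌊ n /2⌋ ⌈ n /2⌉ ⟩
  ⌊ n /2⌋                        ∎
  where
  open ≤-Reasoning
  ⌈n/2⌉≤1+⌊n/2⌋ : ⌈ n /2⌉ ≤ suc ⌊ n /2⌋
  ⌈n/2⌉≤1+⌊n/2⌋ = ⌊n/2⌋-mono (n≤1+n (suc n))

nCk≤nC⌊n/2⌋ : ∀ n k → n C k ≤ n C ⌊ n /2⌋
nCk≤nC⌊n/2⌋ n k with k ≤? ⌊ n /2⌋ | k ≤? n
... | yes k≤⌊n/2⌋ | _       = nCj≤nCk (≤⇒≤′ k≤⌊n/2⌋) (2⌊n/2⌋≤n n)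
... | no _        | no k≰n  = subst (_≤ n C ⌊ n /2⌋) (sym (k>n⇒nCk≡0 (≰⇒> k≰n))) z≤n
... | no k≰⌊n/2⌋  | yes k≤n = begin
  n C k          ≡⟨ nCk≡nC[n∸k] k≤n ⟩
  n C (n ∸ k)    ≤⟨ nCj≤nCk (≤⇒≤′ (n∸k≤⌊n/2⌋ n k (≰⇒> k≰⌊n/2⌋))) (2⌊n/2⌋≤n n) ⟩
  n C ⌊ n /2⌋    ∎
  where open ≤-Reasoning

parity-suc : ∀ m → parity (suc m) ≡ parity m ⁻¹
parity-suc m = sym (⁻¹-selfInverse (suc-homo-⁻¹ m))

parity[1+m]≢parity[m] : ∀ m → parity (suc m) ≢ parity m
parity[1+m]≢parity[m] m eq = p≢p⁻¹ (parity m) (trans (sym eq) (parity-suc m))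

parity[1+m+m]≡1ℙ : ∀ m → parity (suc (m + m)) ≡ 1ℙ
parity[1+m+m]≡1ℙ m = trans (parity-suc (m + m)) (cong _⁻¹ (trans (+-homo-+ m m) (p+p≡0ℙ (parity m))))

p≢1ℙ⇒p≡0ℙ : ∀ {p} → p ≢ 1ℙ → p ≡ 0ℙ
p≢1ℙ⇒p≡0ℙ {0ℙ} _   = refl
p≢1ℙ⇒p≡0ℙ {1ℙ} p≢1 = contradiction refl p≢1

module _ (G : Graph) where

  run : Pred (V G) 0ℓ → List (List (V G)) → Pred (V G) 0ℓ
  run R []      = R
  run R (h ∷ H) = run (step G R h) H

  Wins-++ : ∀ R H {H′} → Wins G (run R H) H′ → Wins G R (H ++ H′)
  Wins-++ R []      w = w
  Wins-++ R (h ∷ H) w = inj₂ (Wins-++ (step G R h) H w)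

  Empty-run⇒Wins : ∀ R H → Empty (run R H) → Wins G R H
  Empty-run⇒Wins R []      e = e
  Empty-run⇒Wins R (h ∷ H) e = inj₂ (Empty-run⇒Wins (step G R h) H e)

  run-applyUpTo-invariant : (I : ℕ → Pred (V G) 0ℓ) (hs : ℕ → List (V G))
    → (∀ j u v → I j u → ¬ u ∈ hs j → _~_ G u v → I (suc j) v)
    → ∀ k {R} → R ⊆ I 0 → run R (applyUpTo hs k) ⊆ I k
  run-applyUpTo-invariant I hs I-step zero    R⊆I = R⊆I
  run-applyUpTo-invariant I hs I-step (suc k) R⊆I =
    run-applyUpTo-invariant (λ j → I (suc j)) (λ j → hs (suc j)) (λ j → I-step (suc j)) k
      (λ (u , Ru , u∉h , u~v) → I-step 0 u _ (R⊆I Ru) u∉h u~v)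

level : ∀ n → ℕ → List (Subset n)
level zero    zero    = [ [] ]
level zero    (suc k) = []
level (suc n) zero    = map (outside ∷_) (level n zero)
level (suc n) (suc k) = map (inside ∷_) (level n k) ++ map (outside ∷_) (level n (suc k))

length-level : ∀ n k → length (level n k) ≡ n C k
length-level zero    zero    = refl
length-level zero    (suc k) = refl
length-level (suc n) zero    = trans (length-map (outside ∷_) (level n zero)) (length-level n zero)
length-level (suc n) (suc k) = begin
  length (map (inside ∷_) (level n k) ++ map (outside ∷_) (level n (suc k)))
    ≡⟨ length-++ (map (inside ∷_) (level n k)) ⟩
  length (map (inside ∷_) (level n k)) + length (map (outside ∷_) (level n (suc k)))
    ≡⟨ cong₂ _+_ (length-map (inside ∷_) (level n k)) (length-map (outside ∷_) (level n (suc k))) ⟩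
  length (level n k) + length (level n (suc k))
    ≡⟨ cong₂ _+_ (length-level n k) (length-level n (suc k)) ⟩
  n C k + n C suc k
    ≡⟨ nCk+nC[k+1]≡[n+1]C[k+1] n k ⟩
  suc n C suc k ∎
  where open ≡-Reasoning

∈-level : ∀ {n} (v : Subset n) → v ∈ level n ∣ v ∣
∈-level []                = here refl
∈-level (inside ∷ v)      = ∈-++⁺ˡ (∈-map⁺ (inside ∷_) (∈-level v))
∈-level {suc n} (outside ∷ v) with ∣ v ∣ | ∈-level v
... | zero  | v∈ = ∈-map⁺ (outside ∷_) v∈
... | suc k | v∈ = ∈-++⁺ʳ (map (inside ∷_) (level n k)) (∈-map⁺ (outside ∷_) v∈)

△≡0⇒≡ : ∀ {n} (u v : Subset n) → ∣ u △ v ∣ ≡ 0 → u ≡ v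
△≡0⇒≡ []            []            _ = refl
△≡0⇒≡ (inside ∷ u)  (inside ∷ v)  h = cong (inside ∷_) (△≡0⇒≡ u v h)
△≡0⇒≡ (outside ∷ u) (outside ∷ v) h = cong (outside ∷_) (△≡0⇒≡ u v h)

adjacent⇒∣∣-suc : ∀ {n} (u v : Subset n) → _~_ (Q n) u v → ∣ v ∣ ≡ suc ∣ u ∣ ⊎ ∣ u ∣ ≡ suc ∣ v ∣
adjacent⇒∣∣-suc []            []            ()
adjacent⇒∣∣-suc (inside ∷ u)  (inside ∷ v)  h with adjacent⇒∣∣-suc u v h
... | inj₁ e = inj₁ (cong suc e)
... | inj₂ e = inj₂ (cong suc e)
adjacent⇒∣∣-suc (outside ∷ u) (outside ∷ v) h = adjacent⇒∣∣-suc u v h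
adjacent⇒∣∣-suc (inside ∷ u)  (outside ∷ v) h =
  inj₂ (cong (λ w → suc ∣ w ∣) (△≡0⇒≡ u v (suc-injective h)))
adjacent⇒∣∣-suc (outside ∷ u) (inside ∷ v)  h =
  inj₁ (cong (λ w → suc ∣ w ∣) (sym (△≡0⇒≡ u v (suc-injective h))))

adjacent⇒parity-flip : ∀ {n} (u v : Subset n) → _~_ (Q n) u v → parity ∣ v ∣ ≡ parity ∣ u ∣ ⁻¹
adjacent⇒parity-flip u v h with adjacent⇒∣∣-suc u v h
... | inj₁ e = trans (cong parity e) (parity-suc ∣ u ∣)
... | inj₂ e = trans (sym (suc-homo-⁻¹ ∣ v ∣)) (cong (λ m → parity m ⁻¹) (sym e))

module _ {n : ℕ} where

  Aligned : ℕ → Pred (Subset n) 0ℓ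
  Aligned j v = parity ∣ v ∣ ≡ parity j

  AheadOfSweep : ℕ → Pred (Subset n) 0ℓ
  AheadOfSweep j v = Aligned j v → j ≤ ∣ v ∣

  Aligned-step : ∀ j u v → Aligned j u → _~_ (Q n) u v → Aligned (suc j) v
  Aligned-step j u v u-aligned u~v =
    trans (adjacent⇒parity-flip u v u~v) (trans (cong _⁻¹ u-aligned) (sym (parity-suc j)))

  AheadOfSweep-step : ∀ j u v → AheadOfSweep j u → ¬ u ∈ level n j → _~_ (Q n) u v
                    → AheadOfSweep (suc j) v
  AheadOfSweep-step j u v u-ahead u∉level u~v v-aligned =
    ≤∧≢⇒< j≤∣v∣ λ j≡∣v∣ →
      parity[1+m]≢parity[m] j (trans (sym v-aligned) (cong parity (sym j≡∣v∣)))
    where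
    u-aligned : Aligned j u
    u-aligned = begin
      parity ∣ u ∣          ≡⟨ ⁻¹-involutive (parity ∣ u ∣) ⟨
      parity ∣ u ∣ ⁻¹ ⁻¹    ≡⟨ cong _⁻¹ (adjacent⇒parity-flip u v u~v) ⟨
      parity ∣ v ∣ ⁻¹       ≡⟨ cong _⁻¹ v-aligned ⟩
      parity (suc j) ⁻¹     ≡⟨ suc-homo-⁻¹ j ⟩
      parity j              ∎
      where open ≡-Reasoning
    j<∣u∣ : j < ∣ u ∣
    j<∣u∣ = ≤∧≢⇒< (u-ahead u-aligned) λ j≡∣u∣ →
      u∉level (subst (λ k → u ∈ level n k) (sym j≡∣u∣) (∈-level u))
    j≤∣v∣ : j ≤ ∣ v ∣
    j≤∣v∣ with adjacent⇒∣∣-suc u v u~v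
    ... | inj₁ ∣v∣≡1+∣u∣ = subst (j ≤_) (sym ∣v∣≡1+∣u∣) (≤-trans (<⇒≤ j<∣u∣) (n≤1+n ∣ u ∣))
    ... | inj₂ ∣u∣≡1+∣v∣ = ≤-pred (subst (j <_) ∣u∣≡1+∣v∣ j<∣u∣)

  Aligned∩AheadOfSweep-step : ∀ j u v → (Aligned j ∩ AheadOfSweep j) u → ¬ u ∈ level n j
                            → _~_ (Q n) u v → (Aligned (suc j) ∩ AheadOfSweep (suc j)) v
  Aligned∩AheadOfSweep-step j u v (u-aligned , u-ahead) u∉level u~v =
    Aligned-step j u v u-aligned u~v , AheadOfSweep-step j u v u-ahead u∉level u~v

  AheadOfSweep⇒¬Aligned : ∀ {j} → n < j → ∀ v → AheadOfSweep j v → ¬ Aligned j v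
  AheadOfSweep⇒¬Aligned n<j v v-ahead v-aligned = <⇒≱ n<j (≤-trans (v-ahead v-aligned) (∣p∣≤n v))

sweep : ∀ n → List (List (Subset n))
sweep n = applyUpTo (level n) (suc (n + n))

sweep-aligns : ∀ n → run (Q n) U (sweep n) ⊆ Aligned 0
sweep-aligns n {v} v-survives = p≢1ℙ⇒p≡0ℙ λ odd →
  AheadOfSweep⇒¬Aligned (s≤s (m≤m+n n n)) v v-ahead (trans odd (sym (parity[1+m+m]≡1ℙ n)))
  where
  v-ahead : AheadOfSweep (suc (n + n)) v
  v-ahead = run-applyUpTo-invariant (Q n) AheadOfSweep (level n) AheadOfSweep-step _
              (λ _ _ → z≤n) v-survives

sweep-catches-aligned : ∀ n {R} → R ⊆ Aligned 0 → Empty (run (Q n) R (sweep n))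
sweep-catches-aligned n R⊆Aligned v v-survives
  with run-applyUpTo-invariant (Q n) (λ j → Aligned j ∩ AheadOfSweep j) (level n)
         Aligned∩AheadOfSweep-step _ (λ Rv → R⊆Aligned Rv , λ _ → z≤n) v-survives
... | v-aligned , v-ahead = AheadOfSweep⇒¬Aligned (s≤s (m≤m+n n n)) v v-ahead v-aligned

length-sweep≤ : ∀ n → All (λ h → length h ≤ n C (n / 2)) (sweep n)
length-sweep≤ n = applyUpTo⁺₂ (level n) (suc (n + n)) λ k →
  subst₂ _≤_ (sym (length-level n k)) (cong (n C_) (sym (n/2≡⌊n/2⌋ n))) (nCk≤nC⌊n/2⌋ n k)

-- The construction also works for n = 0.
proposition4p2 : (n : ℕ) → 1 ≤ n → Hun≤ (Q n) (n C (n / 2))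
proposition4p2 n _ = sweep n ++ sweep n , sweep-twice-wins , ++⁺ (length-sweep≤ n) (length-sweep≤ n)
  where
  sweep-twice-wins : Winning (Q n) (sweep n ++ sweep n)
  sweep-twice-wins = Wins-++ (Q n) U (sweep n)
    (Empty-run⇒Wins (Q n) (run (Q n) U (sweep n)) (sweep n) (sweep-catches-aligned n (sweep-aligns n)))
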